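{- Let $p>2$ and $d\ge1$. Write $H(1,1)=\langle x_1,y_1,z\rangle$ with $|x_1|=|y_1|=|z|=p$, $z$ central and $[x_1,y_1]=z$, and write $C_{p^{d+1}}=\langle w\rangle$. Let $G_d$ be the subgroup $\langle x_1w,\,y_1,\,z\rangle$ of $H(1,1)\times C_{p^{d+1}}$, and set $\overline{G}_d=G_d/\langle (x_1w)^{p^d}z^{ -1}\rangle=G_d/\langle w^{p^d}z^{ -1}\rangle$. Then $\overline{G}_d\cong A(1,d)$.
   Context: $A(1,d)$ is the group of order $p^{2+d}$ generated by $x_1,y_1,z$ with $|y_1|=p$, $x_1^p=z$, $|z|=p^d$, $z$ central, and $[x_1,y_1]=z^{p^{d-1}}$. -}

module Defs where

open import Level using (0ℓ)
open import Data.Nat as ℕ using (ℕ; zero; suc; _^_; _∸_)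
open import Data.Integer as ℤ using (ℤ; +_; _+_; _-_; _*_; -_)
open import Data.Integer.Divisibility using (_∣_)
open import Data.Product using (Σ; _×_; _,_; proj₁)
open import Algebra.Bundles.Raw using (RawGroup)

module _ (G : RawGroup 0ℓ 0ℓ) where
  open RawGroup G

  pow : Carrier → ℕ → Carrier
  pow g zero    = ε
  pow g (suc n) = g ∙ pow g n

  data ⟨_⟩ (S : Carrier → Set) : Carrier → Set where
    gen  : ∀ {g} → S g → ⟨ S ⟩ g
    one  : ⟨ S ⟩ ε
    mul  : ∀ {g h} → ⟨ S ⟩ g → ⟨ S ⟩ h → ⟨ S ⟩ (g ∙ h)
    inv  : ∀ {g} → ⟨ S ⟩ g → ⟨ S ⟩ (g ⁻¹)
    resp : ∀ {g h} → g ≈ h → ⟨ S ⟩ g → ⟨ S ⟩ h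

  Quotient : (H N : Carrier → Set) →
             (∀ {g h} → H g → H h → H (g ∙ h)) → H ε → (∀ {g} → H g → H (g ⁻¹)) →
             RawGroup 0ℓ 0ℓ
  Quotient H N Hmul Hone Hinv = record
    { Carrier = Σ Carrier H
    ; _≈_     = λ { (g , _) (h , _) → N ((g ⁻¹) ∙ h) }
    ; _∙_     = λ { (g , hg) (h , hh) → (g ∙ h , Hmul hg hh) }
    ; ε       = (ε , Hone)
    ; _⁻¹     = λ { (g , hg) → (g ⁻¹ , Hinv hg) }
    }

data Three {A : Set} (a b c : A) : A → Set where
  is₁ : Three a b c a
  is₂ : Three a b c b
  is₃ : Three a b c c

data Only {A : Set} (a : A) : A → Set where
  is : Only a a

_≡_[mod_] : ℤ → ℤ → ℕ → Set
x ≡ y [mod n ] = (+ n) ∣ (x - y)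

-- H(1,1) × C_{p^{d+1}}
-- An element (a , b , c , e) is the pair (h , w^e) where h is the Heisenberg
-- element (a , b , c) with multiplication
--   (a,b,c)(a',b',c') = (a+a', b+b', c+c'+a b')
-- (x₁ = (1,0,0), y₁ = (0,1,0), z = (0,0,1), so [x₁,y₁] = z, z central,
--  all of order p), times the element w^e of the cyclic group of order p^{d+1}.

HC : Set
HC = ℤ × ℤ × ℤ × ℤ

HxC : (p d : ℕ) → RawGroup 0ℓ 0ℓ
HxC p d = record
  { Carrier = HC
  ; _≈_ = λ { (a , b , c , e) (a' , b' , c' , e') →
              (a ≡ a' [mod p ]) × (b ≡ b' [mod p ]) × (c ≡ c' [mod p ]) ×
              (e ≡ e' [mod p ^ suc d ]) }
  ; _∙_ = λ { (a , b , c , e) (a' , b' , c' , e') →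
              (a + a' , b + b' , c + c' + a * b' , e + e') }
  ; ε = (+ 0 , + 0 , + 0 , + 0)
  ; _⁻¹ = λ { (a , b , c , e) → (- a , - b , - c + a * b , - e) }
  }

x₁ y₁ z w : HC
x₁ = (+ 1 , + 0 , + 0 , + 0)
y₁ = (+ 0 , + 1 , + 0 , + 0)
z  = (+ 0 , + 0 , + 1 , + 0)
w  = (+ 0 , + 0 , + 0 , + 1)

module _ (p d : ℕ) where
  open RawGroup (HxC p d)

  InG : HC → Set
  InG = ⟨_⟩ (HxC p d) (Three (x₁ ∙ w) y₁ z)

  InN : HC → Set
  InN = ⟨_⟩ (HxC p d) (Only (pow (HxC p d) (x₁ ∙ w) (p ^ d) ∙ z ⁻¹))

  Gbar : RawGroup 0ℓ 0ℓ
  Gbar = Quotient (HxC p d) InG InN mul one inv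

data Term (X : Set) : Set where
  var : X → Term X
  e   : Term X
  _·_ : Term X → Term X → Term X
  _⁻¹ : Term X → Term X

infixl 7 _·_
infix 8 _⁻¹

tpow : {X : Set} → Term X → ℕ → Term X
tpow t zero    = e
tpow t (suc n) = t · tpow t n

data Eq {X : Set} (R : Term X → Term X → Set) : Term X → Term X → Set where
  refl′  : ∀ {s} → Eq R s s
  sym′   : ∀ {s t} → Eq R s t → Eq R t s
  trans′ : ∀ {s t u} → Eq R s t → Eq R t u → Eq R s u
  ·-cong : ∀ {s s' t t'} → Eq R s s' → Eq R t t' → Eq R (s · t) (s' · t')
  ⁻¹-cong : ∀ {s t} → Eq R s t → Eq R (s ⁻¹) (t ⁻¹)
  assoc  : ∀ {s t u} → Eq R ((s · t) · u) (s · (t · u))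
  idˡ    : ∀ {s} → Eq R (e · s) s
  idʳ    : ∀ {s} → Eq R (s · e) s
  invˡ   : ∀ {s} → Eq R (s ⁻¹ · s) e
  invʳ   : ∀ {s} → Eq R (s · s ⁻¹) e
  rel    : ∀ {s t} → R s t → Eq R s t

Presented : (X : Set) → (Term X → Term X → Set) → RawGroup 0ℓ 0ℓ
Presented X R = record
  { Carrier = Term X ; _≈_ = Eq R ; _∙_ = _·_ ; ε = e ; _⁻¹ = _⁻¹ }

data Gen : Set where
  gx gy gz : Gen

X Y Z : Term Gen
X = var gx
Y = var gy
Z = var gz

comm : {A : Set} → Term A → Term A → Term A
comm a b = a ⁻¹ · b ⁻¹ · a · b

data RelA (p d : ℕ) : Term Gen → Term Gen → Set where
  r-y   : RelA p d (tpow Y p) e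
  r-x   : RelA p d (tpow X p) Z
  r-z   : RelA p d (tpow Z (p ^ d)) e
  r-zx  : RelA p d (Z · X) (X · Z)
  r-zy  : RelA p d (Z · Y) (Y · Z)
  r-xy  : RelA p d (comm X Y) (tpow Z (p ^ (d ∸ 1)))

A : (p d : ℕ) → RawGroup 0ℓ 0ℓ
A p d = Presented Gen (RelA p d)

{-# OPTIONS --safe #-}
module Submission where

-- Modulo N the central element z becomes w^(p^d), because x₁ has order p in H(1,1).  Hence the
-- class of (a , b , c , e) ∈ H(1,1) × C_{p^(d+1)} is determined by a and b mod p and by
-- ι = e + c p^d mod p^(d+1); on G_d moreover a ≡ e ≡ ι (mod p).  So g ↦ y₁^b x₁^ι is a
-- well-defined injective map Ḡ_d → A(1,d).  In A(1,d) the relation [x₁,y₁] = z^(p^(d-1)) = x₁^(p^d)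
-- gives x₁^i y₁^j = y₁^j x₁^(i(1 + j p^d)), matching ι(gh) = ι(g) + ι(h) + a b′ p^d, so the map is
-- a homomorphism.  Its inverse is induced by x₁ ↦ x₁w, y₁ ↦ y₁, z ↦ (x₁w)^p, which respects the
-- defining relations of A(1,d).

import Defs
open Defs using (_≡_[mod_]; Term; tpow; Eq; module Eq; ⟨_⟩; Gbar; A)
open import Level using (0ℓ)
open import Data.Nat as ℕ using (ℕ; zero; suc; NonZero; _<_; _≤_)
import Data.Nat.Properties as ℕ
import Data.Nat.Divisibility as ℕ
open import Data.Nat.Primality using (Prime)
open import Data.Integer as ℤ using (ℤ; +_; _+_; _*_; _-_; -_; _%ℕ_; _/ℕ_)
import Data.Integer.Properties as ℤ
import Data.Integer.Divisibility.Signed as Signed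
open import Data.Integer.DivMod using (a≡a%ℕn+[a/ℕn]*n)
open import Data.Integer.Tactic.RingSolver using (solve-∀; solve)
open import Data.List using ([]; _∷_)
open import Data.Product using (Σ; _,_; ∃)
open import Data.Sum using (inj₁; inj₂)
open import Relation.Binary.Bundles using (Setoid)
import Relation.Binary.Reasoning.Setoid as SetoidReasoning
open import Relation.Binary.PropositionalEquality as ≡ using (_≡_)
open import Algebra.Bundles using (Group)
open import Algebra.Bundles.Raw using (RawGroup)
open import Algebra.Morphism.Structures using (module GroupMorphisms)
import Algebra.Properties.Monoid.Mult as MonoidMult
import Algebra.Properties.Semigroup as SemigroupProperties
import Algebra.Properties.Group as GroupProperties

-- The congruence of Defs only mentions x and y under ∣_∣, so Agda cannot infer
-- them from a proof; this record is the same relation as an injective type.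
infix 4 _≡_⟨mod_⟩
record _≡_⟨mod_⟩ (x y : ℤ) (n : ℕ) : Set where
  constructor mod
  field divides : + n Signed.∣ x - y

module _ {n : ℕ} where
  private
    via : ∀ {x y} r → x - y ≡ r → + n Signed.∣ r → x ≡ y ⟨mod n ⟩
    via r eq n∣r = mod (≡.subst (+ n Signed.∣_) (≡.sym eq) n∣r)

  ⟨mod⟩⇒[mod] : ∀ {x y} → x ≡ y ⟨mod n ⟩ → x ≡ y [mod n ]
  ⟨mod⟩⇒[mod] (mod n∣x-y) = Signed.∣⇒∣ᵤ n∣x-y

  [mod]⇒⟨mod⟩ : ∀ {x y} → x ≡ y [mod n ] → x ≡ y ⟨mod n ⟩
  [mod]⇒⟨mod⟩ n∣x-y = mod (Signed.∣ᵤ⇒∣ n∣x-y)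

  mod-reflexive : ∀ {x y} → x ≡ y → x ≡ y ⟨mod n ⟩
  mod-reflexive {x} ≡.refl = via (+ 0) (ℤ.+-inverseʳ x) (Signed.divides (+ 0) ≡.refl)

  mod-refl : ∀ {x} → x ≡ x ⟨mod n ⟩
  mod-refl = mod-reflexive ≡.refl

  mod-sym : ∀ {x y} → x ≡ y ⟨mod n ⟩ → y ≡ x ⟨mod n ⟩
  mod-sym {x} {y} (mod h) = via (- (x - y)) (solve (x ∷ y ∷ [])) (Signed.∣m⇒∣-m h)

  mod-trans : ∀ {x y z} → x ≡ y ⟨mod n ⟩ → y ≡ z ⟨mod n ⟩ → x ≡ z ⟨mod n ⟩
  mod-trans {x} {y} {z} (mod h) (mod k) =
    via ((x - y) + (y - z)) (solve (x ∷ y ∷ z ∷ [])) (Signed.∣m∣n⇒∣m+n h k)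

  +-cong-mod : ∀ {x x′ y y′} → x ≡ x′ ⟨mod n ⟩ → y ≡ y′ ⟨mod n ⟩ → x + y ≡ x′ + y′ ⟨mod n ⟩
  +-cong-mod {x} {x′} {y} {y′} (mod h) (mod k) =
    via ((x - x′) + (y - y′)) (solve (x ∷ x′ ∷ y ∷ y′ ∷ [])) (Signed.∣m∣n⇒∣m+n h k)

  -‿cong-mod : ∀ {x y} → x ≡ y ⟨mod n ⟩ → - x ≡ - y ⟨mod n ⟩
  -‿cong-mod {x} {y} (mod h) = via (- (x - y)) (solve (x ∷ y ∷ [])) (Signed.∣m⇒∣-m h)

  +-congˡ-mod : ∀ k {x y} → x ≡ y ⟨mod n ⟩ → k + x ≡ k + y ⟨mod n ⟩
  +-congˡ-mod k = +-cong-mod (mod-refl {x = k})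

  *-congˡ-mod : ∀ k {x y} → x ≡ y ⟨mod n ⟩ → k * x ≡ k * y ⟨mod n ⟩
  *-congˡ-mod k {x} {y} (mod h) = via (k * (x - y)) (solve (k ∷ x ∷ y ∷ [])) (Signed.∣n⇒∣m*n k h)

  *-congʳ-mod : ∀ k {x y} → x ≡ y ⟨mod n ⟩ → x * k ≡ y * k ⟨mod n ⟩
  *-congʳ-mod k {x} {y} (mod h) = via ((x - y) * k) (solve (k ∷ x ∷ y ∷ [])) (Signed.∣m⇒∣m*n k h)

  *-cong-mod : ∀ {x x′ y y′} → x ≡ x′ ⟨mod n ⟩ → y ≡ y′ ⟨mod n ⟩ → x * y ≡ x′ * y′ ⟨mod n ⟩
  *-cong-mod {x′ = x′} {y = y} h k = mod-trans (*-congʳ-mod y h) (*-congˡ-mod x′ k)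

  %ℕ-mod : ∀ x .{{_ : NonZero n}} → + (x %ℕ n) ≡ x ⟨mod n ⟩
  %ℕ-mod x =
    via (- k * + n) (≡.trans (≡.cong (λ y → + r - y) (a≡a%ℕn+[a/ℕn]*n x n)) (cancel (+ r) k (+ n)))
        (Signed.∣n⇒∣m*n (- k) Signed.∣-refl)
    where
    r = x %ℕ n
    k = x /ℕ n
    cancel : ∀ r k m → r - (r + k * m) ≡ - k * m
    cancel = solve-∀


mod-∣ : ∀ {m n x y} → m ℕ.∣ n → x ≡ y ⟨mod n ⟩ → x ≡ y ⟨mod m ⟩
mod-∣ m∣n h = [mod]⇒⟨mod⟩ (ℕ.∣-trans m∣n (⟨mod⟩⇒[mod] h))

mod⇒∣∸ : ∀ {n i j} → j ℕ.≤ i → + i ≡ + j ⟨mod n ⟩ → n ℕ.∣ i ℕ.∸ j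
mod⇒∣∸ {n} {i} {j} j≤i h =
  ≡.subst (n ℕ.∣_) (≡.cong ℤ.∣_∣ (≡.trans (ℤ.m-n≡m⊖n i j) (ℤ.⊖-≥ j≤i))) (⟨mod⟩⇒[mod] h)

∣⇒≡0-mod : ∀ {n m} → n ℕ.∣ m → + m ≡ + 0 ⟨mod n ⟩
∣⇒≡0-mod {n} {m} n∣m =
  mod (≡.subst (+ n Signed.∣_) (≡.sym (ℤ.+-identityʳ (+ m))) (Signed.∣ᵤ⇒∣ n∣m))

*-scale-mod : ∀ {m x y} k → x ≡ y ⟨mod m ⟩ → x * + k ≡ y * + k ⟨mod m ℕ.* k ⟩
*-scale-mod {m} {x} {y} k (mod h) =
  mod (≡.subst₂ Signed._∣_ (≡.sym (ℤ.pos-* m k)) (distrib x y (+ k)) (Signed.*-monoˡ-∣ (+ k) h))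
  where
  distrib : ∀ x y k → (x - y) * k ≡ x * k - y * k
  distrib = solve-∀

mod-setoid : ℕ → Setoid 0ℓ 0ℓ
mod-setoid n = record
  { Carrier = ℤ ; _≈_ = _≡_⟨mod n ⟩
  ; isEquivalence = record { refl = mod-refl ; sym = mod-sym ; trans = mod-trans } }


module GroupLemmas {c ℓ} (G : Group c ℓ) where
  open Group G
  open MonoidMult monoid using (_×_; ×-congʳ; ×-congˡ; ×-homo-+; ×-assocˡ)
  open SemigroupProperties semigroup using (uv≈wx⇒u∙vy≈w∙xy; uv∙wx≈u[vw∙x]; uv≈wx⇒yu∙vz≈yw∙xz)
  open GroupProperties G using (⁻¹-anti-homo-∙; ⁻¹-injective; inverseˡ-unique)
  open SetoidReasoning setoid

  ⁻¹∙≈ε⇒≈ : ∀ {g h} → g ⁻¹ ∙ h ≈ ε → g ≈ h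
  ⁻¹∙≈ε⇒≈ {g} {h} g⁻¹h≈ε = ⁻¹-injective (inverseˡ-unique (g ⁻¹) h g⁻¹h≈ε)

  ≈⇒⁻¹∙≈ε : ∀ {g h} → g ≈ h → g ⁻¹ ∙ h ≈ ε
  ≈⇒⁻¹∙≈ε {g} g≈h = trans (∙-congˡ (sym g≈h)) (inverseˡ g)

  ×-ε : ∀ k → k × ε ≈ ε
  ×-ε zero    = refl
  ×-ε (suc k) = trans (identityˡ _) (×-ε k)

  ×-period : ∀ {g} n → n × g ≈ ε → ∀ k → (k ℕ.* n) × g ≈ ε
  ×-period {g} n gⁿ≈ε k = begin
    (k ℕ.* n) × g ≈⟨ ×-assocˡ g k n ⟨
    k × (n × g)   ≈⟨ ×-congʳ k gⁿ≈ε ⟩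
    k × ε         ≈⟨ ×-ε k ⟩
    ε             ∎

  ×-mod-≤ : ∀ {g} n → n × g ≈ ε → ∀ {i j} → j ℕ.≤ i → + i ≡ + j ⟨mod n ⟩ → i × g ≈ j × g
  ×-mod-≤ {g} n gⁿ≈ε {i} {j} j≤i i≡j with mod⇒∣∸ j≤i i≡j
  ... | ℕ.divides k i∸j≡kn = begin
    i × g                     ≈⟨ ×-congˡ (ℕ.m+[n∸m]≡n j≤i) ⟨
    (j ℕ.+ (i ℕ.∸ j)) × g     ≈⟨ ×-homo-+ g j (i ℕ.∸ j) ⟩
    j × g ∙ (i ℕ.∸ j) × g     ≈⟨ ∙-congˡ (×-congˡ i∸j≡kn) ⟩
    j × g ∙ (k ℕ.* n) × g     ≈⟨ ∙-congˡ (×-period n gⁿ≈ε k) ⟩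
    j × g ∙ ε                 ≈⟨ identityʳ (j × g) ⟩
    j × g                     ∎

  ×-mod : ∀ {g} n → n × g ≈ ε → ∀ {i j} → + i ≡ + j ⟨mod n ⟩ → i × g ≈ j × g
  ×-mod n gⁿ≈ε {i} {j} i≡j with ℕ.≤-total j i
  ... | inj₁ j≤i = ×-mod-≤ n gⁿ≈ε j≤i i≡j
  ... | inj₂ i≤j = sym (×-mod-≤ n gⁿ≈ε i≤j (mod-sym i≡j))

  ×-commute : ∀ {g h} n → g ∙ h ≈ h ∙ g → g ∙ n × h ≈ n × h ∙ g
  ×-commute zero    gh≈hg = trans (identityʳ _) (sym (identityˡ _))
  ×-commute {g} {h} (suc n) gh≈hg = begin
    g ∙ (h ∙ n × h) ≈⟨ uv≈wx⇒u∙vy≈w∙xy gh≈hg (n × h) ⟩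
    h ∙ (g ∙ n × h) ≈⟨ ∙-congˡ (×-commute n gh≈hg) ⟩
    h ∙ (n × h ∙ g) ≈⟨ assoc h (n × h) g ⟨
    (h ∙ n × h) ∙ g ∎

  commutator⇒swap : ∀ {g h u} → ((g ⁻¹ ∙ h ⁻¹) ∙ g) ∙ h ≈ u → g ∙ h ≈ (h ∙ g) ∙ u
  commutator⇒swap {g} {h} {u} [g,h]≈u = begin
    g ∙ h                                   ≈⟨ identityˡ (g ∙ h) ⟨
    ε ∙ (g ∙ h)                             ≈⟨ ∙-congʳ (inverseʳ (h ∙ g)) ⟨
    ((h ∙ g) ∙ (h ∙ g) ⁻¹) ∙ (g ∙ h)        ≈⟨ assoc (h ∙ g) _ _ ⟩
    (h ∙ g) ∙ ((h ∙ g) ⁻¹ ∙ (g ∙ h))        ≈⟨ ∙-congˡ (∙-congʳ (⁻¹-anti-homo-∙ h g)) ⟩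
    (h ∙ g) ∙ ((g ⁻¹ ∙ h ⁻¹) ∙ (g ∙ h))     ≈⟨ ∙-congˡ (assoc _ g h) ⟨
    (h ∙ g) ∙ (((g ⁻¹ ∙ h ⁻¹) ∙ g) ∙ h)     ≈⟨ ∙-congˡ [g,h]≈u ⟩
    (h ∙ g) ∙ u                             ∎

  module Twisted {x y : Carrier} (c : ℕ)
    (xy≈yx∙xᶜ : x ∙ y ≈ (y ∙ x) ∙ c × x) (xᶜy≈yxᶜ : c × x ∙ y ≈ y ∙ c × x) where

    x∙yʲ : ∀ j → x ∙ j × y ≈ j × y ∙ (1 ℕ.+ j ℕ.* c) × x
    x∙yʲ zero    = sym (identityˡ (x ∙ ε))
    x∙yʲ (suc j) = begin
      x ∙ (y ∙ j × y)               ≈⟨ assoc x y (j × y) ⟨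
      (x ∙ y) ∙ j × y               ≈⟨ ∙-congʳ xy≈yx∙xᶜ ⟩
      ((y ∙ x) ∙ c × x) ∙ j × y     ≈⟨ assoc (y ∙ x) (c × x) (j × y) ⟩
      (y ∙ x) ∙ (c × x ∙ j × y)     ≈⟨ ∙-congˡ (×-commute j xᶜy≈yxᶜ) ⟩
      (y ∙ x) ∙ (j × y ∙ c × x)     ≈⟨ uv∙wx≈u[vw∙x] y x (j × y) (c × x) ⟩
      y ∙ ((x ∙ j × y) ∙ c × x)     ≈⟨ ∙-congˡ (∙-congʳ (x∙yʲ j)) ⟩
      y ∙ ((j × y ∙ n × x) ∙ c × x) ≈⟨ uv∙wx≈u[vw∙x] y (j × y) (n × x) (c × x) ⟨
      (y ∙ j × y) ∙ (n × x ∙ c × x) ≈⟨ ∙-congˡ (×-homo-+ x n c) ⟨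
      (y ∙ j × y) ∙ (n ℕ.+ c) × x   ≈⟨ ∙-congˡ (×-congˡ (≡.cong suc (ℕ.+-comm (j ℕ.* c) c))) ⟩
      (y ∙ j × y) ∙ (1 ℕ.+ suc j ℕ.* c) × x ∎
      where n = 1 ℕ.+ j ℕ.* c

    xⁱ∙yʲ : ∀ i j → i × x ∙ j × y ≈ j × y ∙ (i ℕ.* (1 ℕ.+ j ℕ.* c)) × x
    xⁱ∙yʲ zero    j = trans (identityˡ (j × y)) (sym (identityʳ (j × y)))
    xⁱ∙yʲ (suc i) j = begin
      (x ∙ i × x) ∙ j × y             ≈⟨ assoc x (i × x) (j × y) ⟩
      x ∙ (i × x ∙ j × y)             ≈⟨ ∙-congˡ (xⁱ∙yʲ i j) ⟩
      x ∙ (j × y ∙ (i ℕ.* n) × x)     ≈⟨ assoc x (j × y) _ ⟨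
      (x ∙ j × y) ∙ (i ℕ.* n) × x     ≈⟨ ∙-congʳ (x∙yʲ j) ⟩
      (j × y ∙ n × x) ∙ (i ℕ.* n) × x ≈⟨ assoc (j × y) (n × x) _ ⟩
      j × y ∙ (n × x ∙ (i ℕ.* n) × x) ≈⟨ ∙-congˡ (×-homo-+ x n (i ℕ.* n)) ⟨
      j × y ∙ (suc i ℕ.* n) × x       ∎
      where n = 1 ℕ.+ j ℕ.* c

    normal-form-∙ : ∀ i j i′ j′ → (j × y ∙ i × x) ∙ (j′ × y ∙ i′ × x) ≈
                    (j ℕ.+ j′) × y ∙ (i ℕ.* (1 ℕ.+ j′ ℕ.* c) ℕ.+ i′) × x
    normal-form-∙ i j i′ j′ = begin
      (j × y ∙ i × x) ∙ (j′ × y ∙ i′ × x)    ≈⟨ uv≈wx⇒yu∙vz≈yw∙xz (xⁱ∙yʲ i j′) (j × y) (i′ × x) ⟩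
      (j × y ∙ j′ × y) ∙ (m × x ∙ i′ × x)    ≈⟨ ∙-cong (×-homo-+ y j j′) (×-homo-+ x m i′) ⟨
      (j ℕ.+ j′) × y ∙ (m ℕ.+ i′) × x        ∎
      where m = i ℕ.* (1 ℕ.+ j′ ℕ.* c)

module Presentation {X : Set} (R : Term X → Term X → Set) where
  open Term

  presented : Group 0ℓ 0ℓ
  presented = record
    { Carrier = Term X ; _≈_ = Eq R ; _∙_ = _·_ ; ε = e ; _⁻¹ = _⁻¹
    ; isGroup = record
      { isMonoid = record
        { isSemigroup = record
          { isMagma = record
            { isEquivalence = record { refl = Eq.refl′ ; sym = Eq.sym′ ; trans = Eq.trans′ }
            ; ∙-cong = Eq.·-cong }
          ; assoc = λ _ _ _ → Eq.assoc }
        ; identity = (λ _ → Eq.idˡ) , (λ _ → Eq.idʳ) }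
      ; inverse = (λ _ → Eq.invˡ) , (λ _ → Eq.invʳ)
      ; ⁻¹-cong = Eq.⁻¹-cong } }

  open MonoidMult (Group.monoid presented) using (_×_)

  tpow≡× : ∀ t n → tpow t n ≡ n × t
  tpow≡× t zero    = ≡.refl
  tpow≡× t (suc n) = ≡.cong (t ·_) (tpow≡× t n)

  module Evaluation {c ℓ} (H : Group c ℓ) (v : X → Group.Carrier H) where
    open Group H renaming (_⁻¹ to inv)
    open MonoidMult monoid renaming (_×_ to _×ᴴ_)

    eval : Term X → Carrier
    eval (var x) = v x
    eval e       = ε
    eval (s · t) = eval s ∙ eval t
    eval (s ⁻¹)  = inv (eval s)

    eval-× : ∀ t n → eval (n × t) ≡ n ×ᴴ eval t
    eval-× t zero    = ≡.refl
    eval-× t (suc n) = ≡.cong (eval t ∙_) (eval-× t n)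

    eval-resp : (∀ {s t} → R s t → eval s ≈ eval t) → ∀ {s t} → Eq R s t → eval s ≈ eval t
    eval-resp relations = go
      where
      go : ∀ {s t} → Eq R s t → eval s ≈ eval t
      go Eq.refl′               = refl
      go (Eq.sym′ s≈t)          = sym (go s≈t)
      go (Eq.trans′ s≈t t≈u)    = trans (go s≈t) (go t≈u)
      go (Eq.·-cong s≈s′ t≈t′)  = ∙-cong (go s≈s′) (go t≈t′)
      go (Eq.⁻¹-cong s≈t)       = ⁻¹-cong (go s≈t)
      go Eq.assoc               = assoc _ _ _
      go Eq.idˡ                 = identityˡ _
      go Eq.idʳ                 = identityʳ _
      go Eq.invˡ                = inverseˡ _
      go Eq.invʳ                = inverseʳ _
      go (Eq.rel r)             = relations r

module _ (G : RawGroup 0ℓ 0ℓ) where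
  open RawGroup G
  open ⟨_⟩

  ⟨⟩-smallest : ∀ {S P : Carrier → Set} → (∀ {g} → S g → P g) → P ε →
                (∀ {g h} → P g → P h → P (g ∙ h)) → (∀ {g} → P g → P (g ⁻¹)) →
                (∀ {g h} → g ≈ h → P g → P h) → ∀ {g} → ⟨ G ⟩ S g → P g
  ⟨⟩-smallest {S} {P} S⊆P P-ε P-∙ P-⁻¹ P-resp = go
    where
    go : ∀ {g} → ⟨ G ⟩ S g → P g
    go (gen s)      = S⊆P s
    go one          = P-ε
    go (mul g h)    = P-∙ (go g) (go h)
    go (inv g)      = P-⁻¹ (go g)
    go (resp g≈h g) = P-resp g≈h (go g)

module Construction (p d′ : ℕ) .{{_ : NonZero p}} where
  open Defs using (HC; HxC; x₁; y₁; z; w; pow; InG; InN; Only; Three)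
  open RawGroup (HxC p (suc d′)) using () renaming (_∙_ to _⊙_; _⁻¹ to _⁻¹ᴴ; ε to 1ᴴ; _≈_ to _≈ᴴ_)

  d Q q : ℕ
  d = suc d′
  Q = p ℕ.^ d
  q = p ℕ.^ suc d

  ex ey ew : HC → ℤ
  ex (a , _) = a
  ey (_ , b , _) = b
  ew (_ , _ , _ , e) = e

  ι : HC → ℤ
  ι (_ , _ , c , e) = e + c * + Q

  ι-⊙ : ∀ g h → ι (g ⊙ h) ≡ ι g + ι h + ex g * ey h * + Q
  ι-⊙ (a , b , c , e) (a′ , b′ , c′ , e′) = expand a b c e a′ b′ c′ e′ (+ Q)
    where
    expand : ∀ a b c e a′ b′ c′ e′ Q →
             (e + e′) + (c + c′ + a * b′) * Q ≡ (e + c * Q) + (e′ + c′ * Q) + a * b′ * Q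
    expand = solve-∀

  ι-⁻¹ : ∀ g → ι (g ⁻¹ᴴ) ≡ - ι g + ex g * ey g * + Q
  ι-⁻¹ (a , b , c , e) = expand a b c e (+ Q)
    where
    expand : ∀ a b c e Q → - e + (- c + a * b) * Q ≡ - (e + c * Q) + a * b * Q
    expand = solve-∀

  HC-≡ : ∀ {a b c e a′ b′ c′ e′} → a ≡ a′ → b ≡ b′ → c ≡ c′ → e ≡ e′ →
         _≡_ {A = HC} (a , b , c , e) (a′ , b′ , c′ , e′)
  HC-≡ ≡.refl ≡.refl ≡.refl ≡.refl = ≡.refl

  ⊙-assoc : ∀ f g h → (f ⊙ g) ⊙ h ≡ f ⊙ (g ⊙ h)
  ⊙-assoc (a , b , c , e) (a′ , b′ , c′ , e′) (a″ , b″ , c″ , e″) =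
    HC-≡ (ℤ.+-assoc a a′ a″) (ℤ.+-assoc b b′ b″) (expand a b c a′ b′ c′ b″ c″) (ℤ.+-assoc e e′ e″)
    where
    expand : ∀ a b c a′ b′ c′ b″ c″ →
             (c + c′ + a * b′) + c″ + (a + a′) * b″ ≡ c + (c′ + c″ + a′ * b″) + a * (b′ + b″)
    expand = solve-∀

  ⊙-identityˡ : ∀ g → 1ᴴ ⊙ g ≡ g
  ⊙-identityˡ (a , b , c , e) =
    HC-≡ (ℤ.+-identityˡ a) (ℤ.+-identityˡ b) (expand b c) (ℤ.+-identityˡ e)
    where
    expand : ∀ b c → + 0 + c + + 0 * b ≡ c
    expand = solve-∀

  ⊙-identityʳ : ∀ g → g ⊙ 1ᴴ ≡ g
  ⊙-identityʳ (a , b , c , e) =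
    HC-≡ (ℤ.+-identityʳ a) (ℤ.+-identityʳ b) (expand a c) (ℤ.+-identityʳ e)
    where
    expand : ∀ a c → c + + 0 + a * + 0 ≡ c
    expand = solve-∀

  ⊙-inverseˡ : ∀ g → g ⁻¹ᴴ ⊙ g ≡ 1ᴴ
  ⊙-inverseˡ (a , b , c , e) =
    HC-≡ (ℤ.+-inverseˡ a) (ℤ.+-inverseˡ b) (expand a b c) (ℤ.+-inverseˡ e)
    where
    expand : ∀ a b c → (- c + a * b) + c + (- a) * b ≡ + 0
    expand = solve-∀

  ⊙-inverseʳ : ∀ g → g ⊙ g ⁻¹ᴴ ≡ 1ᴴ
  ⊙-inverseʳ (a , b , c , e) =
    HC-≡ (ℤ.+-inverseʳ a) (ℤ.+-inverseʳ b) (expand a b c) (ℤ.+-inverseʳ e)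
    where
    expand : ∀ a b c → c + (- c + a * b) + a * (- b) ≡ + 0
    expand = solve-∀

  infix 4 _∼_
  record _∼_ (g h : HC) : Set where
    constructor ∼⟨_,_,_⟩
    field
      ex-mod : ex g ≡ ex h ⟨mod p ⟩
      ey-mod : ey g ≡ ey h ⟨mod p ⟩
      ι-mod  : ι g ≡ ι h ⟨mod q ⟩

  ∼-reflexive : ∀ {g h} → g ≡ h → g ∼ h
  ∼-reflexive ≡.refl = ∼⟨ mod-refl , mod-refl , mod-refl ⟩

  ∼-sym : ∀ {g h} → g ∼ h → h ∼ g
  ∼-sym ∼⟨ a , b , i ⟩ = ∼⟨ mod-sym a , mod-sym b , mod-sym i ⟩

  ∼-trans : ∀ {f g h} → f ∼ g → g ∼ h → f ∼ h
  ∼-trans ∼⟨ a , b , i ⟩ ∼⟨ a′ , b′ , i′ ⟩ = ∼⟨ mod-trans a a′ , mod-trans b b′ , mod-trans i i′ ⟩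

  ≈ᴴ⇒∼ : ∀ {g h} → g ≈ᴴ h → g ∼ h
  ≈ᴴ⇒∼ {_ , _ , c , e} {_ , _ , c′ , e′} (a≡a′ , b≡b′ , c≡c′ , e≡e′) =
    ∼⟨ [mod]⇒⟨mod⟩ a≡a′
     , [mod]⇒⟨mod⟩ b≡b′
     , +-cong-mod ([mod]⇒⟨mod⟩ {x = e} {y = e′} e≡e′)
                  (*-scale-mod Q ([mod]⇒⟨mod⟩ {x = c} {y = c′} c≡c′)) ⟩

  ⊙-cong : ∀ {g g′ h h′} → g ∼ g′ → h ∼ h′ → g ⊙ h ∼ g′ ⊙ h′
  ⊙-cong {g} {g′} {h} {h′} ∼⟨ a , b , i ⟩ ∼⟨ a′ , b′ , i′ ⟩ =
    ∼⟨ +-cong-mod a a′ , +-cong-mod b b′ , ι-cong ⟩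
    where
    open SetoidReasoning (mod-setoid q)
    ι-cong : ι (g ⊙ h) ≡ ι (g′ ⊙ h′) ⟨mod q ⟩
    ι-cong = begin
      ι (g ⊙ h)                           ≡⟨ ι-⊙ g h ⟩
      ι g + ι h + ex g * ey h * + Q       ≈⟨ +-cong-mod (+-cong-mod i i′)
                                                        (*-scale-mod Q (*-cong-mod a b′)) ⟩
      ι g′ + ι h′ + ex g′ * ey h′ * + Q   ≡⟨ ι-⊙ g′ h′ ⟨
      ι (g′ ⊙ h′)                         ∎

  ⁻¹ᴴ-cong : ∀ {g h} → g ∼ h → g ⁻¹ᴴ ∼ h ⁻¹ᴴ
  ⁻¹ᴴ-cong {g} {h} ∼⟨ a , b , i ⟩ = ∼⟨ -‿cong-mod a , -‿cong-mod b , ι-cong ⟩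
    where
    open SetoidReasoning (mod-setoid q)
    ι-cong : ι (g ⁻¹ᴴ) ≡ ι (h ⁻¹ᴴ) ⟨mod q ⟩
    ι-cong = begin
      ι (g ⁻¹ᴴ)                       ≡⟨ ι-⁻¹ g ⟩
      - ι g + ex g * ey g * + Q       ≈⟨ +-cong-mod (-‿cong-mod i)
                                                    (*-scale-mod Q (*-cong-mod a b)) ⟩
      - ι h + ex h * ey h * + Q       ≡⟨ ι-⁻¹ h ⟨
      ι (h ⁻¹ᴴ)                       ∎

  H/N : Group 0ℓ 0ℓ
  H/N = record
    { Carrier = HC ; _≈_ = _∼_ ; _∙_ = _⊙_ ; ε = 1ᴴ ; _⁻¹ = _⁻¹ᴴ
    ; isGroup = record
      { isMonoid = record
        { isSemigroup = record
          { isMagma = record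
            { isEquivalence = record { refl = ∼-reflexive ≡.refl ; sym = ∼-sym ; trans = ∼-trans }
            ; ∙-cong = ⊙-cong }
          ; assoc = λ f g h → ∼-reflexive (⊙-assoc f g h) }
        ; identity = (λ g → ∼-reflexive (⊙-identityˡ g)) , (λ g → ∼-reflexive (⊙-identityʳ g)) }
      ; inverse = (λ g → ∼-reflexive (⊙-inverseˡ g)) , (λ g → ∼-reflexive (⊙-inverseʳ g))
      ; ⁻¹-cong = ⁻¹ᴴ-cong } }

  open MonoidMult (Group.monoid H/N) using () renaming (_×_ to _×ᴴ_; ×-assocˡ to ×ᴴ-assocˡ)
  open Only
  open ⟨_⟩

  pow≡×ᴴ : ∀ g n → pow (HxC p d) g n ≡ n ×ᴴ g
  pow≡×ᴴ g zero    = ≡.refl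
  pow≡×ᴴ g (suc n) = ≡.cong (g ⊙_) (pow≡×ᴴ g n)

  ×ᴴ-x₁w : ∀ n → n ×ᴴ (x₁ ⊙ w) ≡ (+ n , + 0 , + 0 , + n)
  ×ᴴ-x₁w zero = ≡.refl
  ×ᴴ-x₁w (suc n) rewrite ×ᴴ-x₁w n = ≡.refl

  g₀ : HC
  g₀ = (+ Q , + 0 , - + 1 , + Q)

  N-generator≡g₀ : pow (HxC p d) (x₁ ⊙ w) Q ⊙ z ⁻¹ᴴ ≡ g₀
  N-generator≡g₀ rewrite pow≡×ᴴ (x₁ ⊙ w) Q | ×ᴴ-x₁w Q =
    HC-≡ (ℤ.+-identityʳ (+ Q)) ≡.refl (expand (+ Q)) (ℤ.+-identityʳ (+ Q))
    where
    expand : ∀ Q → + 0 + - + 1 + Q * + 0 ≡ - + 1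
    expand = solve-∀

  ×ᴴ-g₀ : ∀ m → m ×ᴴ g₀ ≡ (+ (m ℕ.* Q) , + 0 , - + m , + (m ℕ.* Q))
  ×ᴴ-g₀ zero    = ≡.refl
  ×ᴴ-g₀ (suc m) rewrite ×ᴴ-g₀ m = HC-≡ ≡.refl ≡.refl (expand (+ m) (+ Q)) ≡.refl
    where
    expand : ∀ m Q → - + 1 + - m + Q * + 0 ≡ - (+ 1 + m)
    expand = solve-∀

  p∣Q : p ℕ.∣ Q
  p∣Q = ℕ.m∣m*n (p ℕ.^ d′)

  p∣q : p ℕ.∣ q
  p∣q = ℕ.m∣m*n Q

  g₀∼1 : g₀ ∼ 1ᴴ
  g₀∼1 = ∼⟨ ∣⇒≡0-mod p∣Q , mod-refl , mod-reflexive (cancel (+ Q)) ⟩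
    where
    cancel : ∀ Q → Q + - + 1 * Q ≡ + 0 + + 0 * Q
    cancel = solve-∀

  InN⇒∼1 : ∀ {g} → InN p d g → g ∼ 1ᴴ
  InN⇒∼1 = ⟨⟩-smallest (HxC p d) generator∼1 (∼-reflexive ≡.refl) ⊙-cong ⁻¹ᴴ-cong
    (λ g≈ᴴh g∼1 → ∼-trans (∼-sym (≈ᴴ⇒∼ g≈ᴴh)) g∼1)
    where
    generator∼1 : ∀ {g} → Only (pow (HxC p d) (x₁ ⊙ w) Q ⊙ z ⁻¹ᴴ) g → g ∼ 1ᴴ
    generator∼1 is = ∼-trans (∼-reflexive N-generator≡g₀) g₀∼1

  g₀∈N : InN p d g₀
  g₀∈N = ≡.subst (InN p d) N-generator≡g₀ (gen is)

  ×ᴴ-g₀∈N : ∀ m → InN p d (m ×ᴴ g₀)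
  ×ᴴ-g₀∈N zero    = one
  ×ᴴ-g₀∈N (suc m) = mul g₀∈N (×ᴴ-g₀∈N m)

  ∼1⇒InN : ∀ {g} → g ∼ 1ᴴ → InN p d g
  ∼1⇒InN {a , b , c , e} ∼⟨ a≡0 , b≡0 , ι≡0 ⟩ =
    resp (≡.subst (_≈ᴴ (a , b , c , e)) (≡.sym (×ᴴ-g₀ m))
           (⟨mod⟩⇒[mod] a-mod , ⟨mod⟩⇒[mod] (mod-sym b≡0) , ⟨mod⟩⇒[mod] c-mod , ⟨mod⟩⇒[mod] e-mod))
         (×ᴴ-g₀∈N m)
    where
    m = (- c) %ℕ p

    a-mod : + (m ℕ.* Q) ≡ a ⟨mod p ⟩
    a-mod = mod-trans (∣⇒≡0-mod (ℕ.∣-trans p∣Q (ℕ.n∣m*n m))) (mod-sym a≡0)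

    c-mod : - + m ≡ c ⟨mod p ⟩
    c-mod = mod-trans (-‿cong-mod (%ℕ-mod (- c))) (mod-reflexive (ℤ.neg-involutive c))

    e-mod : + (m ℕ.* Q) ≡ e ⟨mod q ⟩
    e-mod = begin
      + (m ℕ.* Q)                   ≡⟨ ℤ.pos-* m Q ⟩
      + m * + Q                     ≈⟨ *-scale-mod Q (%ℕ-mod (- c)) ⟩
      - c * + Q                     ≡⟨ ℤ.+-identityʳ (- c * + Q) ⟨
      - c * + Q + + 0               ≈⟨ +-congˡ-mod (- c * + Q) (mod-sym ι≡0) ⟩
      - c * + Q + (e + c * + Q)     ≡⟨ cancel c e (+ Q) ⟩
      e                             ∎
      where
      open SetoidReasoning (mod-setoid q)
      cancel : ∀ c e Q → - c * Q + (e + c * Q) ≡ e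
      cancel = solve-∀

  open GroupLemmas H/N using (⁻¹∙≈ε⇒≈; ≈⇒⁻¹∙≈ε) renaming (×-commute to ×ᴴ-commute)

  Gbar-≈⇒∼ : ∀ g h → InN p d (g ⁻¹ᴴ ⊙ h) → g ∼ h
  Gbar-≈⇒∼ _ _ g⁻¹h∈N = ⁻¹∙≈ε⇒≈ (InN⇒∼1 g⁻¹h∈N)

  ∼⇒Gbar-≈ : ∀ {g h} → g ∼ h → InN p d (g ⁻¹ᴴ ⊙ h)
  ∼⇒Gbar-≈ g∼h = ∼1⇒InN (≈⇒⁻¹∙≈ε g∼h)

  InG⇒ex≡ew : ∀ {g} → InG p d g → ex g ≡ ew g ⟨mod p ⟩
  InG⇒ex≡ew = ⟨⟩-smallest (HxC p d) generators mod-refl +-cong-mod -‿cong-mod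
    (λ {g} {h} → respects-≈ᴴ {g} {h})
    where
    generators : ∀ {g} → Three (x₁ ⊙ w) y₁ z g → ex g ≡ ew g ⟨mod p ⟩
    generators Three.is₁ = mod-refl
    generators Three.is₂ = mod-refl
    generators Three.is₃ = mod-refl

    respects-≈ᴴ : ∀ {g h} → g ≈ᴴ h → ex g ≡ ew g ⟨mod p ⟩ → ex h ≡ ew h ⟨mod p ⟩
    respects-≈ᴴ {a , b , c , e} {a′ , b′ , c′ , e′} (a≡a′ , _ , _ , e≡e′) a≡e =
      mod-trans (mod-sym ([mod]⇒⟨mod⟩ {x = a} a≡a′))
                (mod-trans a≡e (mod-∣ p∣q ([mod]⇒⟨mod⟩ {x = e} e≡e′)))

  InG⇒ex≡ι : ∀ {g} → InG p d g → ex g ≡ ι g ⟨mod p ⟩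
  InG⇒ex≡ι {g} g∈G = mod-trans (InG⇒ex≡ew g∈G) (mod-sym (ι≡ew g))
    where
    ι≡ew : ∀ g → ι g ≡ ew g ⟨mod p ⟩
    ι≡ew (_ , _ , c , e) = begin
      e + c * + Q   ≈⟨ +-congˡ-mod e (*-congˡ-mod c (∣⇒≡0-mod p∣Q)) ⟩
      e + c * + 0   ≡⟨ vanish e c ⟩
      e             ∎
      where
      open SetoidReasoning (mod-setoid p)
      vanish : ∀ e c → e + c * + 0 ≡ e
      vanish = solve-∀

  ∼-swap : ∀ g h → ex g * ey h ≡ ex h * ey g ⟨mod p ⟩ → g ⊙ h ∼ h ⊙ g
  ∼-swap g h commutes =
    ∼⟨ mod-reflexive (ℤ.+-comm (ex g) (ex h)) , mod-reflexive (ℤ.+-comm (ey g) (ey h)) , ι-comm ⟩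
    where
    open SetoidReasoning (mod-setoid q)
    ι-comm : ι (g ⊙ h) ≡ ι (h ⊙ g) ⟨mod q ⟩
    ι-comm = begin
      ι (g ⊙ h)                       ≡⟨ ι-⊙ g h ⟩
      ι g + ι h + ex g * ey h * + Q   ≈⟨ +-cong-mod (mod-reflexive (ℤ.+-comm (ι g) (ι h)))
                                                    (*-scale-mod Q commutes) ⟩
      ι h + ι g + ex h * ey g * + Q   ≡⟨ ι-⊙ h g ⟨
      ι (h ⊙ g)                       ∎

  ×ᴴ-y₁ : ∀ n → n ×ᴴ y₁ ≡ (+ 0 , + n , + 0 , + 0)
  ×ᴴ-y₁ zero = ≡.refl
  ×ᴴ-y₁ (suc n) rewrite ×ᴴ-y₁ n = ≡.refl

  ×ᴴ-x₁w∈G : ∀ n → InG p d (n ×ᴴ (x₁ ⊙ w))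
  ×ᴴ-x₁w∈G zero    = one
  ×ᴴ-x₁w∈G (suc n) = mul (gen Three.is₁) (×ᴴ-x₁w∈G n)

  open Defs using (Gen; gx; gy; gz; X; Y; Z; RelA; comm)
  open Presentation (RelA p d) using (presented; tpow≡×; module Evaluation)
  open Group presented
    using (_≈_; _∙_; ε; _⁻¹; sym; trans; ∙-cong; ∙-congˡ; ∙-congʳ; ⁻¹-cong; identityˡ; identityʳ)
  open MonoidMult (Group.monoid presented) using (_×_; ×-congˡ; ×-congʳ; ×-assocˡ)
  open GroupLemmas presented using (×-mod; ×-commute; commutator⇒swap; module Twisted)
  open GroupProperties presented using (inverseˡ-unique)

  Yᵖ≈ε : p × Y ≈ ε
  Yᵖ≈ε = ≡.subst (_≈ ε) (tpow≡× Y p) (Eq.rel RelA.r-y)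

  Xᵖ≈Z : p × X ≈ Z
  Xᵖ≈Z = ≡.subst (_≈ Z) (tpow≡× X p) (Eq.rel RelA.r-x)

  Zᵠ≈ε : Q × Z ≈ ε
  Zᵠ≈ε = ≡.subst (_≈ ε) (tpow≡× Z Q) (Eq.rel RelA.r-z)

  [X,Y]≈Zᵖᵈ′ : comm X Y ≈ (p ℕ.^ d′) × Z
  [X,Y]≈Zᵖᵈ′ = ≡.subst (comm X Y ≈_) (tpow≡× Z (p ℕ.^ d′)) (Eq.rel RelA.r-xy)

  Xᵖⁿ≈Zⁿ : ∀ n → (p ℕ.* n) × X ≈ n × Z
  Xᵖⁿ≈Zⁿ n = begin
    (p ℕ.* n) × X   ≈⟨ ×-congˡ (ℕ.*-comm p n) ⟩
    (n ℕ.* p) × X   ≈⟨ ×-assocˡ X n p ⟨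
    n × (p × X)     ≈⟨ ×-congʳ n Xᵖ≈Z ⟩
    n × Z           ∎
    where open SetoidReasoning (Group.setoid presented)

  Xᵍ≈ε : q × X ≈ ε
  Xᵍ≈ε = trans (Xᵖⁿ≈Zⁿ Q) Zᵠ≈ε

  XY≈YX∙Xᵠ : X ∙ Y ≈ (Y ∙ X) ∙ Q × X
  XY≈YX∙Xᵠ = commutator⇒swap (trans [X,Y]≈Zᵖᵈ′ (sym (Xᵖⁿ≈Zⁿ (p ℕ.^ d′))))

  XᵠY≈YXᵠ : Q × X ∙ Y ≈ Y ∙ Q × X
  XᵠY≈YXᵠ = begin
    Q × X ∙ Y               ≈⟨ ∙-congʳ (Xᵖⁿ≈Zⁿ (p ℕ.^ d′)) ⟩
    (p ℕ.^ d′) × Z ∙ Y      ≈⟨ ×-commute (p ℕ.^ d′) (sym (Eq.rel RelA.r-zy)) ⟨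
    Y ∙ (p ℕ.^ d′) × Z      ≈⟨ ∙-congˡ (Xᵖⁿ≈Zⁿ (p ℕ.^ d′)) ⟨
    Y ∙ Q × X               ∎
    where open SetoidReasoning (Group.setoid presented)

  open Twisted Q XY≈YX∙Xᵠ XᵠY≈YXᵠ using (normal-form-∙)

  instance
    q≢0 : NonZero q
    q≢0 = ℕ.m^n≢0 p (suc d)

  toA : HC → Term Gen
  toA g = (ey g %ℕ p) × Y ∙ (ι g %ℕ q) × X

  toA-≈ : ∀ g {i j} → ey g ≡ + j ⟨mod p ⟩ → ι g ≡ + i ⟨mod q ⟩ → toA g ≈ j × Y ∙ i × X
  toA-≈ g ey≡j ι≡i = ∙-cong (×-mod p Yᵖ≈ε (mod-trans (%ℕ-mod (ey g)) ey≡j))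
                            (×-mod q Xᵍ≈ε (mod-trans (%ℕ-mod (ι g)) ι≡i))

  toA-cong : ∀ {g h} → g ∼ h → toA g ≈ toA h
  toA-cong {g} {h} ∼⟨ _ , ey≡ , ι≡ ⟩ =
    toA-≈ g (mod-trans ey≡ (mod-sym (%ℕ-mod (ey h)))) (mod-trans ι≡ (mod-sym (%ℕ-mod (ι h))))

  toA-1 : toA 1ᴴ ≈ ε
  toA-1 = trans (toA-≈ 1ᴴ {0} {0} mod-refl mod-refl) (identityˡ ε)

  toA-⊙ : ∀ {g} h → InG p d g → toA (g ⊙ h) ≈ toA g ∙ toA h
  toA-⊙ {g} h g∈G = trans (toA-≈ (g ⊙ h) ey-⊙ ι-⊙-mod) (sym (normal-form-∙ i j i′ j′))
    where
    i  = ι g %ℕ q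
    j  = ey g %ℕ p
    i′ = ι h %ℕ q
    j′ = ey h %ℕ p

    ey-⊙ : ey g + ey h ≡ + (j ℕ.+ j′) ⟨mod p ⟩
    ey-⊙ = mod-trans (+-cong-mod (mod-sym (%ℕ-mod (ey g))) (mod-sym (%ℕ-mod (ey h))))
                     (mod-reflexive (≡.sym (ℤ.pos-+ j j′)))

    ι-⊙-mod : ι (g ⊙ h) ≡ + (i ℕ.* (1 ℕ.+ j′ ℕ.* Q) ℕ.+ i′) ⟨mod q ⟩
    ι-⊙-mod = begin
      ι (g ⊙ h)                            ≡⟨ ι-⊙ g h ⟩
      ι g + ι h + ex g * ey h * + Q        ≈⟨ +-cong-mod (+-cong-mod ι≡i ι′≡i′)
                                                         (*-scale-mod Q (*-cong-mod ex≡i ey′≡j′)) ⟩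
      + i + + i′ + + i * + j′ * + Q        ≡⟨ regroup (+ i) (+ i′) (+ j′) (+ Q) ⟩
      + i * (+ 1 + + j′ * + Q) + + i′      ≡⟨ ≡.cong (λ k → + i * (+ 1 + k) + + i′) (ℤ.pos-* j′ Q) ⟨
      + i * + (1 ℕ.+ j′ ℕ.* Q) + + i′      ≡⟨ ≡.cong (_+ + i′) (ℤ.pos-* i (1 ℕ.+ j′ ℕ.* Q)) ⟨
      + (i ℕ.* (1 ℕ.+ j′ ℕ.* Q)) + + i′    ≡⟨ ℤ.pos-+ (i ℕ.* (1 ℕ.+ j′ ℕ.* Q)) i′ ⟨
      + (i ℕ.* (1 ℕ.+ j′ ℕ.* Q) ℕ.+ i′)    ∎
      where
      open SetoidReasoning (mod-setoid q)
      regroup : ∀ i i′ j′ Q → i + i′ + i * j′ * Q ≡ i * (+ 1 + j′ * Q) + i′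
      regroup = solve-∀
      ι≡i : ι g ≡ + i ⟨mod q ⟩
      ι≡i = mod-sym (%ℕ-mod (ι g))
      ι′≡i′ : ι h ≡ + i′ ⟨mod q ⟩
      ι′≡i′ = mod-sym (%ℕ-mod (ι h))
      ex≡i : ex g ≡ + i ⟨mod p ⟩
      ex≡i = mod-trans (InG⇒ex≡ι g∈G) (mod-∣ p∣q ι≡i)
      ey′≡j′ : ey h ≡ + j′ ⟨mod p ⟩
      ey′≡j′ = mod-sym (%ℕ-mod (ey h))

  toA-⁻¹ : ∀ {g} → InG p d g → toA (g ⁻¹ᴴ) ≈ toA g ⁻¹
  toA-⁻¹ {g} g∈G = inverseˡ-unique (toA (g ⁻¹ᴴ)) (toA g) (begin
    toA (g ⁻¹ᴴ) ∙ toA g   ≈⟨ toA-⊙ g (inv g∈G) ⟨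
    toA (g ⁻¹ᴴ ⊙ g)       ≈⟨ toA-cong (∼-reflexive (⊙-inverseˡ g)) ⟩
    toA 1ᴴ                ≈⟨ toA-1 ⟩
    ε                     ∎)
    where open SetoidReasoning (Group.setoid presented)

  generator-image : Gen → HC
  generator-image gx = x₁ ⊙ w
  generator-image gy = y₁
  generator-image gz = p ×ᴴ (x₁ ⊙ w)

  open Evaluation H/N generator-image
    renaming (eval to fromA; eval-× to fromA-×; eval-resp to fromA-resp)

  fromA-∈G : ∀ t → InG p d (fromA t)
  fromA-∈G (Term.var gx) = gen Three.is₁
  fromA-∈G (Term.var gy) = gen Three.is₂
  fromA-∈G (Term.var gz) = ×ᴴ-x₁w∈G p
  fromA-∈G Term.e        = one
  fromA-∈G (s Term.· t)  = mul (fromA-∈G s) (fromA-∈G t)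
  fromA-∈G (t Term.⁻¹)   = inv (fromA-∈G t)

  fromA-tpow : ∀ t n → fromA (tpow t n) ≡ n ×ᴴ fromA t
  fromA-tpow t n = ≡.trans (≡.cong fromA (tpow≡× t n)) (fromA-× t n)

  ×ᴴ-×ᴴ-x₁w : ∀ m n → m ×ᴴ (n ×ᴴ (x₁ ⊙ w)) ∼ (+ (m ℕ.* n) , + 0 , + 0 , + (m ℕ.* n))
  ×ᴴ-×ᴴ-x₁w m n = ∼-trans (×ᴴ-assocˡ (x₁ ⊙ w) m n) (∼-reflexive (×ᴴ-x₁w (m ℕ.* n)))

  x₁wᵖ-commutes-y₁ : p ×ᴴ (x₁ ⊙ w) ⊙ y₁ ∼ y₁ ⊙ p ×ᴴ (x₁ ⊙ w)
  x₁wᵖ-commutes-y₁ rewrite ×ᴴ-x₁w p =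
    ∼-swap (+ p , + 0 , + 0 , + p) y₁
      (mod-trans (mod-reflexive (ℤ.*-identityʳ (+ p))) (∣⇒≡0-mod ℕ.∣-refl))

  fromA-relations : ∀ {s t} → RelA p d s t → fromA s ∼ fromA t
  fromA-relations RelA.r-y  = ∼-trans (∼-reflexive (≡.trans (fromA-tpow Y p) (×ᴴ-y₁ p)))
                                     ∼⟨ mod-refl , ∣⇒≡0-mod ℕ.∣-refl , mod-refl ⟩
  fromA-relations RelA.r-x  = ∼-reflexive (fromA-tpow X p)
  fromA-relations RelA.r-z  = ∼-trans (∼-trans (∼-reflexive (fromA-tpow Z Q)) (×ᴴ-×ᴴ-x₁w Q p))
    ∼⟨ ∣⇒≡0-mod (ℕ.n∣m*n Q) , mod-refl ,
       mod-trans (mod-reflexive (ℤ.+-identityʳ (+ (Q ℕ.* p))))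
                 (∣⇒≡0-mod (ℕ.∣-reflexive (ℕ.*-comm p Q))) ⟩
  fromA-relations RelA.r-zx = ∼-sym (×ᴴ-commute p (∼-reflexive ≡.refl))
  fromA-relations RelA.r-zy = x₁wᵖ-commutes-y₁
  fromA-relations RelA.r-xy = ∼-sym
    (∼-trans (∼-trans (∼-reflexive (fromA-tpow Z (p ℕ.^ d′))) (×ᴴ-×ᴴ-x₁w (p ℕ.^ d′) p))
             ∼⟨ ∣⇒≡0-mod (ℕ.n∣m*n (p ℕ.^ d′)) , mod-refl , mod-reflexive ι-eq ⟩)
    where
    ι-eq : + (p ℕ.^ d′ ℕ.* p) + + 0 * + Q ≡ + 0 + + 1 * + Q
    ι-eq = ≡.trans (≡.cong (λ k → + k + + 0 * + Q) (ℕ.*-comm (p ℕ.^ d′) p)) (shuffle (+ Q))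
      where
      shuffle : ∀ Q → Q + + 0 * Q ≡ + 0 + + 1 * Q
      shuffle = solve-∀

  fromA-toA : ∀ {g} → InG p d g → fromA (toA g) ∼ g
  fromA-toA {g} g∈G =
    ∼-trans (∼-reflexive (≡.cong₂ _⊙_ (≡.trans (fromA-× Y j) (×ᴴ-y₁ j))
                                      (≡.trans (fromA-× X i) (×ᴴ-x₁w i))))
    ∼⟨ mod-trans (mod-∣ p∣q (%ℕ-mod (ι g))) (mod-sym (InG⇒ex≡ι g∈G))
     , mod-trans (mod-reflexive (ℤ.+-identityʳ (+ j))) (%ℕ-mod (ey g))
     , mod-trans (mod-reflexive (ℤ.+-identityʳ (+ i))) (%ℕ-mod (ι g)) ⟩
    where
    i = ι g %ℕ q
    j = ey g %ℕ p

  toA-fromA : ∀ t → toA (fromA t) ≈ t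
  toA-fromA (Term.var gx) =
    trans (toA-≈ (x₁ ⊙ w) {1} {0} mod-refl mod-refl) (trans (identityˡ (X ∙ ε)) (identityʳ X))
  toA-fromA (Term.var gy) =
    trans (toA-≈ y₁ {0} {1} mod-refl mod-refl) (trans (identityʳ (Y ∙ ε)) (identityʳ Y))
  toA-fromA (Term.var gz) rewrite ×ᴴ-x₁w p =
    trans (toA-≈ (+ p , + 0 , + 0 , + p) {p} {0} mod-refl (mod-reflexive (ℤ.+-identityʳ (+ p))))
          (trans (identityˡ (p × X)) Xᵖ≈Z)
  toA-fromA Term.e        = toA-1
  toA-fromA (s Term.· t)  = trans (toA-⊙ (fromA t) (fromA-∈G s)) (∙-cong (toA-fromA s) (toA-fromA t))
  toA-fromA (t Term.⁻¹)   = trans (toA-⁻¹ (fromA-∈G t)) (⁻¹-cong (toA-fromA t))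

  toA-injective : ∀ {g h} → InG p d g → InG p d h → toA g ≈ toA h → g ∼ h
  toA-injective g∈G h∈G toAg≈toAh =
    ∼-trans (∼-sym (fromA-toA g∈G)) (∼-trans (fromA-resp fromA-relations toAg≈toAh) (fromA-toA h∈G))

  open GroupMorphisms (Gbar p d) (A p d)

  Ḡ→A : Σ HC (InG p d) → Term Gen
  Ḡ→A (g , _) = toA g

  Ḡ≅A : IsGroupIsomorphism Ḡ→A
  Ḡ≅A = record
    { isGroupMonomorphism = record
      { isGroupHomomorphism = record
        { isMonoidHomomorphism = record
          { isMagmaHomomorphism = record
            { isRelHomomorphism = record
              { cong = λ {(g , _)} {(h , _)} g≈h → toA-cong (Gbar-≈⇒∼ g h g≈h) }
            ; homo = λ (_ , g∈G) (h , _) → toA-⊙ h g∈G }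
          ; ε-homo = toA-1 }
        ; ⁻¹-homo = λ (_ , g∈G) → toA-⁻¹ g∈G }
      ; injective = λ {(_ , g∈G)} {(_ , h∈G)} toAg≈toAh →
          ∼⇒Gbar-≈ (toA-injective g∈G h∈G toAg≈toAh) }
    ; surjective = λ t → (fromA t , fromA-∈G t) , λ {(g , _)} g≈t →
        trans (toA-cong (Gbar-≈⇒∼ g (fromA t) g≈t)) (toA-fromA t) }

proposition4p5 : (p d : ℕ) → Prime p → 2 < p → 1 ≤ d →
    ∃ λ f → GroupMorphisms.IsGroupIsomorphism (Gbar p d) (A p d) f
proposition4p5 zero    _        _ () _
proposition4p5 _       zero     _ _  ()
proposition4p5 p@(suc _) (suc d′) _ _ _ = Construction.Ḡ→A p d′ , Construction.Ḡ≅A p d′
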